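{- If a finitary type theory derives $\Theta\vdash\Gamma\ \mathsf{ctx}$ and $\Theta;\Gamma\vdash\lceil\mathcal{B}\!\!\mathcal{B}\rceil(e\equiv e')$, where $\mathcal{B}\!\!\mathcal{B}$ is an (abstracted) object boundary, then it derives $\Theta;\Gamma\vdash\lceil\mathcal{B}\!\!\mathcal{B}\rceil(e')$.
   Context: Finitary type theories. Expressions are built from free variables, bound variables, symbol applications $S(\vec e)$ and metavariable applications $M(\vec t)$; arguments may be dummies $\star$ or abstractions $\{x\}e$. Object boundaries are "$\Box$ type", "$\Box:A$" and their abstractions $\{x_1:A_1\}\cdots\{x_n:A_n\}\mathcal B$. $\lceil\mathcal{B}\!\!\mathcal{B}\rceil(e)$ fills the hole with $e$ (with $\lceil\{x:A\}\mathcal{B}\!\!\mathcal{B}\rceil(\{x\}e)=\{x:A\}\lceil\mathcal{B}\!\!\mathcal{B}\rceil(e)$); $\lceil\mathcal{B}\!\!\mathcal{B}\rceil(e\equiv e')$ is the equation: $\lceil\Box\text{ type}\rceil(A\equiv B)$ is $A\equiv B$, $\lceil\Box:C\rceil(s\equiv t)$ is $s\equiv t:C$, and $\lceil\{x:A\}\mathcal{B}\!\!\mathcal{B}\rceil(\{x\}e\equiv\{x\}e')=\{x:A\}\lceil\mathcal{B}\!\!\mathcal{B}\rceil(e\equiv e')$. Hypothetical judgements $\Theta;\Gamma\vdash\mathcal J$, with $\Theta$ a metavariable context assigning boundaries to metavariables and $\Gamma=[a_1:A_1,\ldots,a_n:A_n]$ a variable context. A raw type theory is a family of raw rules $\Xi\Longrightarrow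 J$ (judgements $\Xi;\emptyset\vdash J$), whose derivability is generated by structural rules (variable, metavariable, abstraction: from $\Theta;\Gamma\vdash A$ type, $a\notin|\Gamma|$ and $\Theta;\Gamma,a:A\vdash\mathcal J[a/x]$ infer $\Theta;\Gamma\vdash\{x:A\}\mathcal J$; reflexivity, symmetry, transitivity, conversion; boundary formation), instances of its rules (substituting arguments for metavariables) and congruence rules of object rules. It is finitary if each rule $\Xi\Longrightarrow\lceil\mathcal B\rceil(e)$ has $\Xi$ well formed and $\Xi;\emptyset\vdash\mathcal B$ derivable. $\Theta\vdash\Gamma\ \mathsf{ctx}$ means: $\Theta$ is a well-formed metavariable context (each boundary is derivable over the preceding metavariables with empty variable context) and $\Theta;a_1:A_1,\ldots,a_{i-1}:A_{i-1}\vdash A_i$ type for each $i$. -}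

module Defs where

-- Finitary type theories in the sense of Bauer–Haselwarter–Lumsdaine,
-- with well-scoped de Bruijn syntax.

open import Data.Nat using (ℕ; zero; suc)
open import Data.Fin using (Fin; zero; suc)
open import Data.Product using (_×_; _,_)
open import Data.Unit using (⊤; tt)
open import Relation.Binary.PropositionalEquality using (_≡_)

data Sort : Set where
  ty tm : Sort

data Class : Set where
  obj : Sort → Class
  eqn : Sort → Class

-- Arity of a metavariable / of a symbol argument:
-- (class, number of bound variables).
MArity : Set
MArity = Class × ℕ

-- Shapes: snoc-lists of arities (shape of a metavariable context,
-- and argument arities of a symbol).
infixl 5 _▷_
data Shape : Set where
  ε   : Shape
  _▷_ : Shape → MArity → Shape

data _∈ₘ_ (a : MArity) : Shape → Set where
  here  : ∀ {Ξ} → a ∈ₘ (Ξ ▷ a)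
  there : ∀ {Ξ b} → a ∈ₘ Ξ → a ∈ₘ (Ξ ▷ b)

infixl 6 _⊕_
_⊕_ : ℕ → ℕ → ℕ
n ⊕ zero  = n
n ⊕ suc k = suc n ⊕ k

record Signature : Set₁ where
  field
    Sym   : Set
    sort  : Sym → Sort
    arity : Sym → Shape

module TT (𝕊 : Signature) where
  open Signature 𝕊

  data Expr (𝓜 : Shape) (n : ℕ) : Sort → Set
  data Args (𝓜 : Shape) (n : ℕ) : Shape → Set
  data Tms  (𝓜 : Shape) (n : ℕ) : ℕ → Set

  data Expr 𝓜 n where
    var  : Fin n → Expr 𝓜 n tm
    sym  : (S : Sym) → Args 𝓜 n (arity S) → Expr 𝓜 n (sort S)
    meta : ∀ {s k} → (obj s , k) ∈ₘ 𝓜 → Tms 𝓜 n k → Expr 𝓜 n s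

  -- arguments: abstractions {x⃗}e for object arities, dummies ⋆ for
  -- equational arities.  Args 𝓜 n Ξ is also an instantiation of Ξ.
  data Args 𝓜 n where
    ε    : Args 𝓜 n ε
    _▷ₒ_ : ∀ {Ξ s k} → Args 𝓜 n Ξ → Expr 𝓜 (n ⊕ k) s → Args 𝓜 n (Ξ ▷ (obj s , k))
    _▷⋆  : ∀ {Ξ s k} → Args 𝓜 n Ξ → Args 𝓜 n (Ξ ▷ (eqn s , k))

  -- term arguments of a metavariable application (first = outermost)
  data Tms 𝓜 n where
    []  : Tms 𝓜 n zero
    _∷_ : ∀ {k} → Expr 𝓜 n tm → Tms 𝓜 n k → Tms 𝓜 n (suc k)

  Filler : Shape → ℕ → Class → ℕ → Set
  Filler 𝓜 n (obj s) k = Expr 𝓜 (n ⊕ k) s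
  Filler 𝓜 n (eqn s) k = ⊤

  argAt : ∀ {𝓜 n Ξ s k} → Args 𝓜 n Ξ → (obj s , k) ∈ₘ Ξ → Expr 𝓜 (n ⊕ k) s
  argAt (I ▷ₒ e) here      = e
  argAt (I ▷ₒ e) (there M) = argAt I M
  argAt (I ▷⋆)   (there M) = argAt I M

  Ren : ℕ → ℕ → Set
  Ren n m = Fin n → Fin m

  liftR : ∀ {n m} → Ren n m → Ren (suc n) (suc m)
  liftR ρ zero    = zero
  liftR ρ (suc i) = suc (ρ i)

  liftRN : ∀ {n m} k → Ren n m → Ren (n ⊕ k) (m ⊕ k)
  liftRN zero    ρ = ρ
  liftRN (suc k) ρ = liftRN k (liftR ρ)

  wkRN : ∀ {n} k → Ren n (n ⊕ k)
  wkRN zero    i = i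
  wkRN (suc k) i = wkRN k (suc i)

  ren     : ∀ {𝓜 n m s} → Ren n m → Expr 𝓜 n s → Expr 𝓜 m s
  renArgs : ∀ {𝓜 n m Ξ} → Ren n m → Args 𝓜 n Ξ → Args 𝓜 m Ξ
  renTms  : ∀ {𝓜 n m k} → Ren n m → Tms 𝓜 n k → Tms 𝓜 m k
  ren ρ (var i)     = var (ρ i)
  ren ρ (sym S as)  = sym S (renArgs ρ as)
  ren ρ (meta M ts) = meta M (renTms ρ ts)
  renArgs ρ ε                     = ε
  renArgs ρ (_▷ₒ_ {k = k} as e)   = renArgs ρ as ▷ₒ ren (liftRN k ρ) e
  renArgs ρ (as ▷⋆)               = renArgs ρ as ▷⋆
  renTms ρ []       = []
  renTms ρ (t ∷ ts) = ren ρ t ∷ renTms ρ ts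

  Sub : Shape → ℕ → ℕ → Set
  Sub 𝓜 n m = Fin n → Expr 𝓜 m tm

  liftS : ∀ {𝓜 n m} → Sub 𝓜 n m → Sub 𝓜 (suc n) (suc m)
  liftS σ zero    = var zero
  liftS σ (suc i) = ren suc (σ i)

  liftSN : ∀ {𝓜 n m} k → Sub 𝓜 n m → Sub 𝓜 (n ⊕ k) (m ⊕ k)
  liftSN zero    σ = σ
  liftSN (suc k) σ = liftSN k (liftS σ)

  sub     : ∀ {𝓜 n m s} → Sub 𝓜 n m → Expr 𝓜 n s → Expr 𝓜 m s
  subArgs : ∀ {𝓜 n m Ξ} → Sub 𝓜 n m → Args 𝓜 n Ξ → Args 𝓜 m Ξ
  subTms  : ∀ {𝓜 n m k} → Sub 𝓜 n m → Tms 𝓜 n k → Tms 𝓜 m k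
  sub σ (var i)     = σ i
  sub σ (sym S as)  = sym S (subArgs σ as)
  sub σ (meta M ts) = meta M (subTms σ ts)
  subArgs σ ε                   = ε
  subArgs σ (_▷ₒ_ {k = k} as e) = subArgs σ as ▷ₒ sub (liftSN k σ) e
  subArgs σ (as ▷⋆)             = subArgs σ as ▷⋆
  subTms σ []       = []
  subTms σ (t ∷ ts) = sub σ t ∷ subTms σ ts

  _▸_ : ∀ {𝓜 n m} → Sub 𝓜 n m → Expr 𝓜 m tm → Sub 𝓜 (suc n) m
  (σ ▸ t) zero    = t
  (σ ▸ t) (suc i) = σ i

  extN : ∀ {𝓜 n m k} → Sub 𝓜 n m → Tms 𝓜 m k → Sub 𝓜 (n ⊕ k) m
  extN σ []       = σ
  extN σ (t ∷ ts) = extN (σ ▸ t) ts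

  idS : ∀ {𝓜 n} → Sub 𝓜 n n
  idS i = var i

  emptyS : ∀ {𝓜 n} → Sub 𝓜 zero n
  emptyS ()

  MRen : Shape → Shape → Set
  MRen 𝓜 𝓝 = ∀ {a} → a ∈ₘ 𝓜 → a ∈ₘ 𝓝

  mren     : ∀ {𝓜 𝓝 n s} → MRen 𝓜 𝓝 → Expr 𝓜 n s → Expr 𝓝 n s
  mrenArgs : ∀ {𝓜 𝓝 n Ξ} → MRen 𝓜 𝓝 → Args 𝓜 n Ξ → Args 𝓝 n Ξ
  mrenTms  : ∀ {𝓜 𝓝 n k} → MRen 𝓜 𝓝 → Tms 𝓜 n k → Tms 𝓝 n k
  mren μ (var i)     = var i
  mren μ (sym S as)  = sym S (mrenArgs μ as)
  mren μ (meta M ts) = meta (μ M) (mrenTms μ ts)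
  mrenArgs μ ε         = ε
  mrenArgs μ (as ▷ₒ e) = mrenArgs μ as ▷ₒ mren μ e
  mrenArgs μ (as ▷⋆)   = mrenArgs μ as ▷⋆
  mrenTms μ []       = []
  mrenTms μ (t ∷ ts) = mren μ t ∷ mrenTms μ ts

  -- Instantiation of metavariables (of shape Ξ) by arguments I.
  -- I lives in scope p; ν translates that scope to the target scope q,
  -- σ translates the source expression's own (bound) variables.

  inst     : ∀ {𝓜 Ξ p q m s} → Args 𝓜 p Ξ → Sub 𝓜 p q → Sub 𝓜 m q → Expr Ξ m s → Expr 𝓜 q s
  instArgs : ∀ {𝓜 Ξ p q m Δ} → Args 𝓜 p Ξ → Sub 𝓜 p q → Sub 𝓜 m q → Args Ξ m Δ → Args 𝓜 q Δ
  instTms  : ∀ {𝓜 Ξ p q m k} → Args 𝓜 p Ξ → Sub 𝓜 p q → Sub 𝓜 m q → Tms Ξ m k → Tms 𝓜 q k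
  inst I ν σ (var i)     = σ i
  inst I ν σ (sym S as)  = sym S (instArgs I ν σ as)
  inst I ν σ (meta M ts) = sub (extN ν (instTms I ν σ ts)) (argAt I M)
  instArgs I ν σ ε                   = ε
  instArgs I ν σ (_▷ₒ_ {k = k} as e) =
    instArgs I ν σ as ▷ₒ inst I (λ i → ren (wkRN k) (ν i)) (liftSN k σ) e
  instArgs I ν σ (as ▷⋆)             = instArgs I ν σ as ▷⋆
  instTms I ν σ []       = []
  instTms I ν σ (t ∷ ts) = inst I ν σ t ∷ instTms I ν σ ts

  inst₀ : ∀ {𝓜 Ξ n s} → Args 𝓜 n Ξ → Expr Ξ zero s → Expr 𝓜 n s
  inst₀ I e = inst I idS emptyS e

  data BdryB (𝓜 : Shape) (n : ℕ) : Class → Set where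
    □type     : BdryB 𝓜 n (obj ty)
    □∶_       : Expr 𝓜 n ty → BdryB 𝓜 n (obj tm)
    _≡_by□    : Expr 𝓜 n ty → Expr 𝓜 n ty → BdryB 𝓜 n (eqn ty)
    _≡ₜ_∶_by□  : Expr 𝓜 n tm → Expr 𝓜 n tm → Expr 𝓜 n ty → BdryB 𝓜 n (eqn tm)

  data Bdry (𝓜 : Shape) (n : ℕ) : Class → ℕ → Set where
    base : ∀ {c} → BdryB 𝓜 n c → Bdry 𝓜 n c zero
    abs  : ∀ {c k} → Expr 𝓜 n ty → Bdry 𝓜 (suc n) c k → Bdry 𝓜 n c (suc k)

  data JudgB (𝓜 : Shape) (n : ℕ) : Set where
    _type    : Expr 𝓜 n ty → JudgB 𝓜 n
    _∶_      : Expr 𝓜 n tm → Expr 𝓜 n ty → JudgB 𝓜 n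
    _≡ty_    : Expr 𝓜 n ty → Expr 𝓜 n ty → JudgB 𝓜 n
    _≡ₜ_∶_    : Expr 𝓜 n tm → Expr 𝓜 n tm → Expr 𝓜 n ty → JudgB 𝓜 n

  data Judg (𝓜 : Shape) (n : ℕ) : Set where
    base : JudgB 𝓜 n → Judg 𝓜 n
    abs  : Expr 𝓜 n ty → Judg 𝓜 (suc n) → Judg 𝓜 n

  fillB : ∀ {𝓜 n c} → BdryB 𝓜 n c → Filler 𝓜 n c zero → JudgB 𝓜 n
  fillB □type              e = e type
  fillB (□∶ A)             e = e ∶ A
  fillB (A ≡ B by□)        _ = A ≡ty B
  fillB (s ≡ₜ t ∶ A by□)    _ = s ≡ₜ t ∶ A

  fill : ∀ {𝓜 n c k} → Bdry 𝓜 n c k → Filler 𝓜 n c k → Judg 𝓜 n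
  fill (base b) f                   = base (fillB b f)
  fill {c = obj s} (abs A B) e      = abs A (fill B e)
  fill {c = eqn s} (abs A B) f      = abs A (fill B f)

  fillEqB : ∀ {𝓜 n s} → BdryB 𝓜 n (obj s) → Expr 𝓜 n s → Expr 𝓜 n s → JudgB 𝓜 n
  fillEqB □type  A B = A ≡ty B
  fillEqB (□∶ C) s t = s ≡ₜ t ∶ C

  fillEq : ∀ {𝓜 n s k} → Bdry 𝓜 n (obj s) k → Expr 𝓜 (n ⊕ k) s → Expr 𝓜 (n ⊕ k) s → Judg 𝓜 n
  fillEq (base b)  e e' = base (fillEqB b e e')
  fillEq (abs A B) e e' = abs A (fillEq B e e')

  subBB : ∀ {𝓜 n m c} → Sub 𝓜 n m → BdryB 𝓜 n c → BdryB 𝓜 m c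
  subBB σ □type           = □type
  subBB σ (□∶ A)          = □∶ sub σ A
  subBB σ (A ≡ B by□)     = sub σ A ≡ sub σ B by□
  subBB σ (s ≡ₜ t ∶ A by□) = sub σ s ≡ₜ sub σ t ∶ sub σ A by□

  bodyAt : ∀ {𝓜 m n c k} → Sub 𝓜 m n → Bdry 𝓜 m c k → Tms 𝓜 n k → BdryB 𝓜 n c
  bodyAt σ (base b)  []       = subBB σ b
  bodyAt σ (abs A B) (t ∷ ts) = bodyAt (σ ▸ t) B ts

  mrenBB : ∀ {𝓜 𝓝 n c} → MRen 𝓜 𝓝 → BdryB 𝓜 n c → BdryB 𝓝 n c
  mrenBB μ □type           = □type
  mrenBB μ (□∶ A)          = □∶ mren μ A
  mrenBB μ (A ≡ B by□)     = mren μ A ≡ mren μ B by□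
  mrenBB μ (s ≡ₜ t ∶ A by□) = mren μ s ≡ₜ mren μ t ∶ mren μ A by□

  mrenBdry : ∀ {𝓜 𝓝 n c k} → MRen 𝓜 𝓝 → Bdry 𝓜 n c k → Bdry 𝓝 n c k
  mrenBdry μ (base b)  = base (mrenBB μ b)
  mrenBdry μ (abs A B) = abs (mren μ A) (mrenBdry μ B)

  instBB : ∀ {𝓜 Ξ p q m c} → Args 𝓜 p Ξ → Sub 𝓜 p q → Sub 𝓜 m q → BdryB Ξ m c → BdryB 𝓜 q c
  instBB I ν σ □type           = □type
  instBB I ν σ (□∶ A)          = □∶ inst I ν σ A
  instBB I ν σ (A ≡ B by□)     = inst I ν σ A ≡ inst I ν σ B by□
  instBB I ν σ (s ≡ₜ t ∶ A by□) = inst I ν σ s ≡ₜ inst I ν σ t ∶ inst I ν σ A by□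

  instBdry : ∀ {𝓜 Ξ p q m c k} → Args 𝓜 p Ξ → Sub 𝓜 p q → Sub 𝓜 m q → Bdry Ξ m c k → Bdry 𝓜 q c k
  instBdry I ν σ (base b)  = base (instBB I ν σ b)
  instBdry I ν σ (abs A B) = abs (inst I ν σ A) (instBdry I (λ i → ren suc (ν i)) (liftS σ) B)

  instBdry₀ : ∀ {𝓜 Ξ n c k} → Args 𝓜 n Ξ → Bdry Ξ zero c k → Bdry 𝓜 n c k
  instBdry₀ I B = instBdry I idS emptyS B

  instBB₀ : ∀ {𝓜 Ξ n c} → Args 𝓜 n Ξ → BdryB Ξ zero c → BdryB 𝓜 n c
  instBB₀ I b = instBB I idS emptyS b

  data MCtx : Shape → Set where
    ε   : MCtx ε
    _▷_ : ∀ {𝓜 c k} → MCtx 𝓜 → Bdry 𝓜 zero c k → MCtx (𝓜 ▷ (c , k))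

  -- Θ(M), weakened to the whole of Θ
  lookupΘ : ∀ {𝓜 c k} → MCtx 𝓜 → (c , k) ∈ₘ 𝓜 → Bdry 𝓜 zero c k
  lookupΘ (Θ ▷ B) here      = mrenBdry there B
  lookupΘ (Θ ▷ B) (there M) = mrenBdry there (lookupΘ Θ M)

  data Ctx (𝓜 : Shape) : ℕ → Set where
    ε   : Ctx 𝓜 zero
    _,_ : ∀ {n} → Ctx 𝓜 n → Expr 𝓜 n ty → Ctx 𝓜 (suc n)

  lookupΓ : ∀ {𝓜 n} → Ctx 𝓜 n → Fin n → Expr 𝓜 n ty
  lookupΓ (Γ , A) zero    = ren suc A
  lookupΓ (Γ , A) (suc i) = ren suc (lookupΓ Γ i)

  data Rule : Set where
    objRule : ∀ {Ξ s} → MCtx Ξ → BdryB Ξ zero (obj s) → Expr Ξ zero s → Rule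
    eqRule  : ∀ {Ξ s} → MCtx Ξ → BdryB Ξ zero (eqn s) → Rule

  record TypeTheory : Set₁ where
    field
      Idx  : Set
      rule : Idx → Rule

  module _ (T : TypeTheory) where
    open TypeTheory T

    data Der {𝓜} (Θ : MCtx 𝓜) : ∀ {n} → Ctx 𝓜 n → Judg 𝓜 n → Set
    data DerB {𝓜} (Θ : MCtx 𝓜) : ∀ {n c k} → Ctx 𝓜 n → Bdry 𝓜 n c k → Set
    data MArgs {𝓜} (Θ : MCtx 𝓜) {n} (Γ : Ctx 𝓜 n) :
      ∀ {m c k} → Sub 𝓜 m n → Bdry 𝓜 m c k → Tms 𝓜 n k → Set
    data MArgsCong {𝓜} (Θ : MCtx 𝓜) {n} (Γ : Ctx 𝓜 n) :
      ∀ {m c k} → Sub 𝓜 m n → Sub 𝓜 m n → Bdry 𝓜 m c k → Tms 𝓜 n k → Tms 𝓜 n k → Set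
    -- extra premise of congruence rules: for term boundaries □ : A, □ : B
    -- the equation A ≡ B
    data BdryEq {𝓜} (Θ : MCtx 𝓜) {n} (Γ : Ctx 𝓜 n) :
      ∀ {c} → BdryB 𝓜 n c → BdryB 𝓜 n c → Set
    data InstDer {𝓜} (Θ : MCtx 𝓜) {n} (Γ : Ctx 𝓜 n) :
      ∀ {Ξ} → MCtx Ξ → Args 𝓜 n Ξ → Set
    data CongDer {𝓜} (Θ : MCtx 𝓜) {n} (Γ : Ctx 𝓜 n) :
      ∀ {Ξ} → MCtx Ξ → Args 𝓜 n Ξ → Args 𝓜 n Ξ → Set

    data Der {𝓜} Θ where
      var : ∀ {n} {Γ : Ctx 𝓜 n} (i : Fin n) →
            Der Θ Γ (base (var i ∶ lookupΓ Γ i))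
      meta : ∀ {n} {Γ : Ctx 𝓜 n} {s k} (M : (obj s , k) ∈ₘ 𝓜) (ts : Tms 𝓜 n k) →
             MArgs Θ Γ emptyS (lookupΘ Θ M) ts →
             DerB Θ Γ (base (bodyAt emptyS (lookupΘ Θ M) ts)) →
             Der Θ Γ (base (fillB (bodyAt emptyS (lookupΘ Θ M) ts) (meta M ts)))
      meta-congr : ∀ {n} {Γ : Ctx 𝓜 n} {s k} (M : (obj s , k) ∈ₘ 𝓜) (ss ts : Tms 𝓜 n k) →
             MArgsCong Θ Γ emptyS emptyS (lookupΘ Θ M) ss ts →
             DerB Θ Γ (base (bodyAt emptyS (lookupΘ Θ M) ss)) →
             DerB Θ Γ (base (bodyAt emptyS (lookupΘ Θ M) ts)) →
             BdryEq Θ Γ (bodyAt emptyS (lookupΘ Θ M) ss) (bodyAt emptyS (lookupΘ Θ M) ts) →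
             Der Θ Γ (base (fillEqB (bodyAt emptyS (lookupΘ Θ M) ss) (meta M ss) (meta M ts)))
      meta-eq : ∀ {n} {Γ : Ctx 𝓜 n} {s k} (M : (eqn s , k) ∈ₘ 𝓜) (ts : Tms 𝓜 n k) →
             MArgs Θ Γ emptyS (lookupΘ Θ M) ts →
             DerB Θ Γ (base (bodyAt emptyS (lookupΘ Θ M) ts)) →
             Der Θ Γ (base (fillB (bodyAt emptyS (lookupΘ Θ M) ts) tt))
      abstr : ∀ {n} {Γ : Ctx 𝓜 n} {A} {J : Judg 𝓜 (suc n)} →
              Der Θ Γ (base (A type)) → Der Θ (Γ , A) J → Der Θ Γ (abs A J)
      eqTy-refl  : ∀ {n} {Γ : Ctx 𝓜 n} {A} →
                   Der Θ Γ (base (A type)) → Der Θ Γ (base (A ≡ty A))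
      eqTy-sym   : ∀ {n} {Γ : Ctx 𝓜 n} {A B} →
                   Der Θ Γ (base (A ≡ty B)) → Der Θ Γ (base (B ≡ty A))
      eqTy-trans : ∀ {n} {Γ : Ctx 𝓜 n} {A B C} →
                   Der Θ Γ (base (A ≡ty B)) → Der Θ Γ (base (B ≡ty C)) → Der Θ Γ (base (A ≡ty C))
      eqTm-refl  : ∀ {n} {Γ : Ctx 𝓜 n} {t A} →
                   Der Θ Γ (base (t ∶ A)) → Der Θ Γ (base (t ≡ₜ t ∶ A))
      eqTm-sym   : ∀ {n} {Γ : Ctx 𝓜 n} {s t A} →
                   Der Θ Γ (base (s ≡ₜ t ∶ A)) → Der Θ Γ (base (t ≡ₜ s ∶ A))
      eqTm-trans : ∀ {n} {Γ : Ctx 𝓜 n} {s t u A} →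
                   Der Θ Γ (base (s ≡ₜ t ∶ A)) → Der Θ Γ (base (t ≡ₜ u ∶ A)) → Der Θ Γ (base (s ≡ₜ u ∶ A))
      conv-tm    : ∀ {n} {Γ : Ctx 𝓜 n} {t A B} →
                   Der Θ Γ (base (t ∶ A)) → Der Θ Γ (base (A ≡ty B)) → Der Θ Γ (base (t ∶ B))
      conv-eqTm  : ∀ {n} {Γ : Ctx 𝓜 n} {s t A B} →
                   Der Θ Γ (base (s ≡ₜ t ∶ A)) → Der Θ Γ (base (A ≡ty B)) → Der Θ Γ (base (s ≡ₜ t ∶ B))
      specific-obj : ∀ {n} {Γ : Ctx 𝓜 n} (r : Idx) {Ξ s} {Ξt : MCtx Ξ}
                     {b : BdryB Ξ zero (obj s)} {e : Expr Ξ zero s} →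
                     rule r ≡ objRule Ξt b e → (I : Args 𝓜 n Ξ) →
                     InstDer Θ Γ Ξt I → DerB Θ Γ (base (instBB₀ I b)) →
                     Der Θ Γ (base (fillB (instBB₀ I b) (inst₀ I e)))
      specific-eq  : ∀ {n} {Γ : Ctx 𝓜 n} (r : Idx) {Ξ s} {Ξt : MCtx Ξ}
                     {b : BdryB Ξ zero (eqn s)} →
                     rule r ≡ eqRule Ξt b → (I : Args 𝓜 n Ξ) →
                     InstDer Θ Γ Ξt I → DerB Θ Γ (base (instBB₀ I b)) →
                     Der Θ Γ (base (fillB (instBB₀ I b) tt))
      congr : ∀ {n} {Γ : Ctx 𝓜 n} (r : Idx) {Ξ s} {Ξt : MCtx Ξ}
              {b : BdryB Ξ zero (obj s)} {e : Expr Ξ zero s} →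
              rule r ≡ objRule Ξt b e → (I J : Args 𝓜 n Ξ) →
              CongDer Θ Γ Ξt I J →
              DerB Θ Γ (base (instBB₀ I b)) → DerB Θ Γ (base (instBB₀ J b)) →
              BdryEq Θ Γ (instBB₀ I b) (instBB₀ J b) →
              Der Θ Γ (base (fillEqB (instBB₀ I b) (inst₀ I e) (inst₀ J e)))

    data DerB {𝓜} Θ where
      bdry-ty    : ∀ {n} {Γ : Ctx 𝓜 n} → DerB Θ Γ (base □type)
      bdry-tm    : ∀ {n} {Γ : Ctx 𝓜 n} {A} →
                   Der Θ Γ (base (A type)) → DerB Θ Γ (base (□∶ A))
      bdry-eqTy  : ∀ {n} {Γ : Ctx 𝓜 n} {A B} →
                   Der Θ Γ (base (A type)) → Der Θ Γ (base (B type)) → DerB Θ Γ (base (A ≡ B by□))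
      bdry-eqTm  : ∀ {n} {Γ : Ctx 𝓜 n} {s t A} →
                   Der Θ Γ (base (A type)) → Der Θ Γ (base (s ∶ A)) → Der Θ Γ (base (t ∶ A)) →
                   DerB Θ Γ (base (s ≡ₜ t ∶ A by□))
      bdry-abstr : ∀ {n} {Γ : Ctx 𝓜 n} {c k} {A} {B : Bdry 𝓜 (suc n) c k} →
                   Der Θ Γ (base (A type)) → DerB Θ (Γ , A) B → DerB Θ Γ (abs A B)

    data MArgs {𝓜} Θ {n} Γ where
      []  : ∀ {m c} {σ : Sub 𝓜 m n} {b : BdryB 𝓜 m c} → MArgs Θ Γ σ (base b) []
      _∷_ : ∀ {m c k} {σ : Sub 𝓜 m n} {A} {B : Bdry 𝓜 (suc m) c k} {t ts} →
            Der Θ Γ (base (t ∶ sub σ A)) → MArgs Θ Γ (σ ▸ t) B ts →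
            MArgs Θ Γ σ (abs A B) (t ∷ ts)

    data MArgsCong {𝓜} Θ {n} Γ where
      []   : ∀ {m c} {σ τ : Sub 𝓜 m n} {b : BdryB 𝓜 m c} → MArgsCong Θ Γ σ τ (base b) [] []
      cons : ∀ {m c k} {σ τ : Sub 𝓜 m n} {A} {B : Bdry 𝓜 (suc m) c k} {s ss t ts} →
             Der Θ Γ (base (s ∶ sub σ A)) → Der Θ Γ (base (t ∶ sub τ A)) →
             Der Θ Γ (base (s ≡ₜ t ∶ sub σ A)) →
             MArgsCong Θ Γ (σ ▸ s) (τ ▸ t) B ss ts →
             MArgsCong Θ Γ σ τ (abs A B) (s ∷ ss) (t ∷ ts)

    data BdryEq {𝓜} Θ {n} Γ where
      ty-case : BdryEq Θ Γ □type □type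
      tm-case : ∀ {A B} → Der Θ Γ (base (A ≡ty B)) → BdryEq Θ Γ (□∶ A) (□∶ B)

    data InstDer {𝓜} Θ {n} Γ where
      ε     : InstDer Θ Γ ε ε
      snocₒ : ∀ {Ξ s k} {Ξt : MCtx Ξ} {B : Bdry Ξ zero (obj s) k} {I} {e} →
              InstDer Θ Γ Ξt I → Der Θ Γ (fill (instBdry₀ I B) e) →
              InstDer Θ Γ (Ξt ▷ B) (I ▷ₒ e)
      snoc⋆ : ∀ {Ξ s k} {Ξt : MCtx Ξ} {B : Bdry Ξ zero (eqn s) k} {I} →
              InstDer Θ Γ Ξt I → Der Θ Γ (fill (instBdry₀ I B) tt) →
              InstDer Θ Γ (Ξt ▷ B) (I ▷⋆)

    data CongDer {𝓜} Θ {n} Γ where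
      ε     : CongDer Θ Γ ε ε ε
      snocₒ : ∀ {Ξ s k} {Ξt : MCtx Ξ} {B : Bdry Ξ zero (obj s) k} {I J} {e e'} →
              CongDer Θ Γ Ξt I J →
              Der Θ Γ (fill (instBdry₀ I B) e) → Der Θ Γ (fill (instBdry₀ J B) e') →
              Der Θ Γ (fillEq (instBdry₀ I B) e e') →
              CongDer Θ Γ (Ξt ▷ B) (I ▷ₒ e) (J ▷ₒ e')
      snoc⋆ : ∀ {Ξ s k} {Ξt : MCtx Ξ} {B : Bdry Ξ zero (eqn s) k} {I J} →
              CongDer Θ Γ Ξt I J →
              Der Θ Γ (fill (instBdry₀ I B) tt) → Der Θ Γ (fill (instBdry₀ J B) tt) →
              CongDer Θ Γ (Ξt ▷ B) (I ▷⋆) (J ▷⋆)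

    MCtxWF : ∀ {𝓜} → MCtx 𝓜 → Set
    MCtxWF ε       = ⊤
    MCtxWF (Θ ▷ B) = MCtxWF Θ × DerB Θ ε B

    CtxTypes : ∀ {𝓜 n} → MCtx 𝓜 → Ctx 𝓜 n → Set
    CtxTypes Θ ε       = ⊤
    CtxTypes Θ (Γ , A) = CtxTypes Θ Γ × Der Θ Γ (base (A type))

    IsCtx : ∀ {𝓜 n} → MCtx 𝓜 → Ctx 𝓜 n → Set
    IsCtx Θ Γ = MCtxWF Θ × CtxTypes Θ Γ

    RuleFinitary : Rule → Set
    RuleFinitary (objRule Ξt b e) = MCtxWF Ξt × DerB Ξt ε (base b)
    RuleFinitary (eqRule Ξt b)    = MCtxWF Ξt × DerB Ξt ε (base b)

    Finitary : Set
    Finitary = (r : Idx) → RuleFinitary (rule r)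

{-# OPTIONS --safe #-}
module Submission where

-- Every rule instance, congruence rule and metavariable rule carries the
-- boundary of its conclusion among its premises, so an induction on
-- derivations shows that both sides of a derivable equation are derivable;
-- conversion transports the right-hand side of a term congruence back to
-- the type of the left-hand one.  The theorem then follows by peeling off
-- the abstractions.

open import Defs
open import Data.Nat using (ℕ)
open import Data.Product using (_×_; _,_; proj₁; proj₂)
open import Data.Unit using (⊤; tt)

module _ (𝕊 : Signature) where
  open TT 𝕊

  module _ (T : TypeTheory) where
    open TypeTheory T

    private variable
      𝓜 Ξ : Shape
      n m k : ℕ
      Θ : MCtx 𝓜
      Γ : Ctx 𝓜 n
      s : Sort
      c : Class

    Sides : MCtx 𝓜 → Ctx 𝓜 n → Judg 𝓜 n → Set
    Sides Θ Γ (base (A ≡ty B))     = Der T Θ Γ (base (A type)) × Der T Θ Γ (base (B type))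
    Sides Θ Γ (base (u ≡ₜ v ∶ A)) = Der T Θ Γ (base (u ∶ A)) × Der T Θ Γ (base (v ∶ A))
    Sides Θ Γ (base (A type))      = ⊤
    Sides Θ Γ (base (u ∶ A))       = ⊤
    Sides Θ Γ (abs A J)            = ⊤

    sides-fillObj : (b : BdryB 𝓜 n (obj s)) (e : Expr 𝓜 n s) → Sides Θ Γ (base (fillB b e))
    sides-fillObj □type  _ = tt
    sides-fillObj (□∶ _) _ = tt

    sides-fillEqn : (b : BdryB 𝓜 n (eqn s)) → DerB T Θ Γ (base b) → Sides Θ Γ (base (fillB b tt))
    sides-fillEqn (A ≡ B by□)      (bdry-eqTy ⊢A ⊢B)    = ⊢A , ⊢B
    sides-fillEqn (u ≡ₜ v ∶ A by□) (bdry-eqTm _ ⊢u ⊢v) = ⊢u , ⊢v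

    sides-fillEqB : {b b' : BdryB 𝓜 n (obj s)} {e e' : Expr 𝓜 n s} →
                    Der T Θ Γ (base (fillB b e)) → Der T Θ Γ (base (fillB b' e')) →
                    BdryEq T Θ Γ b b' → Sides Θ Γ (base (fillEqB b e e'))
    sides-fillEqB ⊢e ⊢e' ty-case       = ⊢e , ⊢e'
    sides-fillEqB ⊢e ⊢e' (tm-case A≡B) = ⊢e , conv-tm ⊢e' (eqTy-sym A≡B)

    MArgsCong⇒MArgs : {σ τ : Sub 𝓜 m n} {B : Bdry 𝓜 m c k} {ss ts : Tms 𝓜 n k} →
                      MArgsCong T Θ Γ σ τ B ss ts → MArgs T Θ Γ σ B ss × MArgs T Θ Γ τ B ts
    MArgsCong⇒MArgs []                    = [] , []
    MArgsCong⇒MArgs (cons ⊢s ⊢t _ ⊢ss≡ts) =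
      let ⊢ss , ⊢ts = MArgsCong⇒MArgs ⊢ss≡ts in (⊢s ∷ ⊢ss) , (⊢t ∷ ⊢ts)

    CongDer⇒InstDer : {Ξt : MCtx Ξ} {I J : Args 𝓜 n Ξ} →
                      CongDer T Θ Γ Ξt I J → InstDer T Θ Γ Ξt I × InstDer T Θ Γ Ξt J
    CongDer⇒InstDer ε = ε , ε
    CongDer⇒InstDer (snocₒ ⊢I≡J ⊢e ⊢e' _) =
      let ⊢I , ⊢J = CongDer⇒InstDer ⊢I≡J in snocₒ ⊢I ⊢e , snocₒ ⊢J ⊢e'
    CongDer⇒InstDer (snoc⋆ ⊢I≡J ⊢p ⊢p') =
      let ⊢I , ⊢J = CongDer⇒InstDer ⊢I≡J in snoc⋆ ⊢I ⊢p , snoc⋆ ⊢J ⊢p'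

    der-sides : {J : Judg 𝓜 n} → Der T Θ Γ J → Sides Θ Γ J
    der-sides (var _)                        = tt
    der-sides (meta _ _ _ _)                 = sides-fillObj _ _
    der-sides (meta-congr M ss ts ⊢ss≡ts ⊢b ⊢b' b≡b') =
      let ⊢ss , ⊢ts = MArgsCong⇒MArgs ⊢ss≡ts
      in sides-fillEqB (meta M ss ⊢ss ⊢b) (meta M ts ⊢ts ⊢b') b≡b'
    der-sides (meta-eq _ _ _ ⊢b)             = sides-fillEqn _ ⊢b
    der-sides (abstr _ _)                    = tt
    der-sides (eqTy-refl ⊢A)                 = ⊢A , ⊢A
    der-sides (eqTy-sym A≡B)                 = let ⊢A , ⊢B = der-sides A≡B in ⊢B , ⊢A
    der-sides (eqTy-trans A≡B B≡C)           = proj₁ (der-sides A≡B) , proj₂ (der-sides B≡C)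
    der-sides (eqTm-refl ⊢t)                 = ⊢t , ⊢t
    der-sides (eqTm-sym u≡v)                 = let ⊢u , ⊢v = der-sides u≡v in ⊢v , ⊢u
    der-sides (eqTm-trans u≡v v≡w)           = proj₁ (der-sides u≡v) , proj₂ (der-sides v≡w)
    der-sides (conv-tm _ _)                  = tt
    der-sides (conv-eqTm u≡v A≡B)            =
      let ⊢u , ⊢v = der-sides u≡v in conv-tm ⊢u A≡B , conv-tm ⊢v A≡B
    der-sides (specific-obj _ _ _ _ _)       = sides-fillObj _ _
    der-sides (specific-eq _ _ _ _ ⊢b)       = sides-fillEqn _ ⊢b
    der-sides (congr r R I J ⊢I≡J ⊢b ⊢b' b≡b') =
      let ⊢I , ⊢J = CongDer⇒InstDer ⊢I≡J
      in sides-fillEqB (specific-obj r R I ⊢I ⊢b) (specific-obj r R J ⊢J ⊢b') b≡b'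

    fillEq⇒fillʳ : (B : Bdry 𝓜 n (obj s) k) {e e' : Expr 𝓜 (n ⊕ k) s} →
                   Der T Θ Γ (fillEq B e e') → Der T Θ Γ (fill B e')
    fillEq⇒fillʳ (base □type)  e≡e'           = proj₂ (der-sides e≡e')
    fillEq⇒fillʳ (base (□∶ _)) e≡e'           = proj₂ (der-sides e≡e')
    fillEq⇒fillʳ (abs _ B)     (abstr ⊢A e≡e') = abstr ⊢A (fillEq⇒fillʳ B e≡e')

lemma2p26 : (𝕊 : Signature) → let open TT 𝕊 in
    (T : TypeTheory) → Finitary T →
    ∀ {𝓜} (Θ : MCtx 𝓜) {n} (Γ : Ctx 𝓜 n) → IsCtx T Θ Γ →
    ∀ {s k} (B : Bdry 𝓜 n (obj s) k) (e e' : Expr 𝓜 (n ⊕ k) s) →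
    Der T Θ Γ (fillEq B e e') → Der T Θ Γ (fill B e')
lemma2p26 𝕊 T _ _ _ _ B _ _ = fillEq⇒fillʳ 𝕊 T B
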